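{- Let $u$ be a uniformly recurrent infinite word over a finite alphabet with no weak bispecial factor. Then for every factor $w$ of $u$, $$\#\mathcal R(w)\ge 1+\Delta C(|w|).$$
   Context: Let $u=u_0u_1\cdots$ be an infinite word over a finite alphabet $\mathcal A$. Factors are finite (possibly empty) words occurring in $u$; $C(n)$ is the number of factors of length $n$ and $\Delta C(n)=C(n+1)-C(n)$. $u$ is uniformly recurrent if for every $n$ every sufficiently long factor contains all factors of length $n$. For a factor $w$, $\mathcal E_\ell(w)=\{a\in\mathcal A: aw \text{ is a factor}\}$, $\mathcal E_r(w)=\{b\in\mathcal A: wb\text{ is a factor}\}$. If $j<k$ are successive occurrences of $w$ (positions $j$ with $u_j\cdots u_{j+|w|-1}=w$), then $u_j\cdots u_{k-1}$ is a return word of $w$; $\mathcal R(w)$ is the set of return words of $w$. The bilateral order of $w$ is $B(w)=\#\{awb \text{ factor of } u: a,b\in\mathcal A\}-\#\mathcal E_\ell(w)-\#\mathcal E_r(w)+1$, and $w$ is weak bispecial if $B(w)<0$. -}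

module Defs where

open import Data.Nat using (ℕ; _+_; _∸_; _<_; _≤_)
open import Data.Fin using (Fin)
open import Data.List using (List; []; _∷_; _++_; length; map; upTo)
open import Data.List.Membership.Propositional using (_∈_)
open import Data.List.Relation.Unary.Unique.Propositional using (Unique)
open import Data.Product using (Σ; ∃; ∃-syntax; _×_; _,_)
open import Relation.Binary.PropositionalEquality using (_≡_)
open import Relation.Nullary using (¬_)
open import Function.Bundles using (_⇔_)

Word : ℕ → Set
Word k = List (Fin k)

InfWord : ℕ → Set
InfWord k = ℕ → Fin k

slice : ∀ {k} → InfWord k → ℕ → ℕ → Word k
slice u i n = map (λ j → u (i + j)) (upTo n)

OccursAt : ∀ {k} → InfWord k → Word k → ℕ → Set
OccursAt u w i = slice u i (length w) ≡ w

Factor : ∀ {k} → InfWord k → Word k → Set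
Factor u w = ∃[ i ] OccursAt u w i

FactorOf : ∀ {k} → Word k → Word k → Set
FactorOf f v = ∃[ p ] ∃[ s ] (p ++ f ++ s ≡ v)

HasCard : {X : Set} → (X → Set) → ℕ → Set
HasCard {X} P m =
  Σ (List X) λ xs → (length xs ≡ m) × Unique xs × (∀ x → (x ∈ xs) ⇔ P x)

-- factors of length n (C(n) is its cardinality)
FactorOfLength : ∀ {k} → InfWord k → ℕ → Word k → Set
FactorOfLength u n w = Factor u w × (length w ≡ n)

UniformlyRecurrent : ∀ {k} → InfWord k → Set
UniformlyRecurrent u =
  ∀ n → ∃[ N ] ∀ v → Factor u v → N ≤ length v →
    ∀ f → Factor u f → length f ≡ n → FactorOf f v

LeftExt : ∀ {k} → InfWord k → Word k → Fin k → Set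
LeftExt u w a = Factor u (a ∷ w)

RightExt : ∀ {k} → InfWord k → Word k → Fin k → Set
RightExt u w b = Factor u (w ++ b ∷ [])

BiExt : ∀ {k} → InfWord k → Word k → Fin k × Fin k → Set
BiExt u w (a , b) = Factor u (a ∷ w ++ b ∷ [])

-- w is weak bispecial: B(w) < 0, where
-- B(w) = #BiExt - #LeftExt - #RightExt + 1 (written additively in ℕ)
WeakBispecial : ∀ {k} → InfWord k → Word k → Set
WeakBispecial u w =
  Factor u w ×
  ∃[ p ] ∃[ l ] ∃[ r ]
    (HasCard (BiExt u w) p × HasCard (LeftExt u w) l × HasCard (RightExt u w) r
     × (p + 1 < l + r))

ReturnWord : ∀ {k} → InfWord k → Word k → Word k → Set
ReturnWord u w r =
  ∃[ j ] ∃[ k ] (j < k × OccursAt u w j × OccursAt u w k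
    × (∀ m → j < m → m < k → ¬ OccursAt u w m)
    × r ≡ slice u j (k ∸ j))

-- Let n = |w| and, for a factor v, rightExcess v = #Rext(v) - 1, so that ΔC(n) is the sum of
-- rightExcess over the words of length n. Call a word of length t + n a node at depth t if it
-- starts with w and w starts at none of its positions 1, ..., t. A node v has 1 + rightExcess v
-- right extensions, each either a node at depth t + 1 or a word p ++ w with p a return word of
-- length t + 1. A factor of length t + n in which w starts at none of the positions 1, ..., t is
-- either a node, or w does not start at position 0 either; in the latter case, since no factor
-- is weak bispecial, its excess is at most the total excess of its left extensions, in which w
-- starts at none of the positions 1, ..., t + 1. Hence the potential
--   Φ t = (total excess of the words of length t + n avoiding w at positions 1, ..., t)
--       + (number of nodes at depth t)
-- satisfies Φ t ≤ Φ (t + 1) + #{return words of length t + 1}. Moreover Φ 0 = ΔC(n) + 1, and by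
-- uniform recurrence Φ vanishes once t exceeds the largest gap between occurrences of w, so
-- telescoping gives 1 + ΔC(n) ≤ #R(w).

module Submission where

open import Defs
open import Algebra.Bundles using (CommutativeMonoid)
import Algebra.Properties.CommutativeSemigroup as CommSemigroupProperties
open import Data.Bool using (Bool; true; false; T; if_then_else_; _∧_; not)
open import Data.Bool.Properties using (T?; T-∧; T-≡; ∧-identityʳ; ∧-commutativeMonoid)
open import Data.Fin using (Fin; _≟_)
open import Data.List
  using (List; []; _∷_; _++_; _∷ʳ_; map; length; filter; concat; concatMap; upTo; applyUpTo;
         allFin; cartesianProductWith; cartesianProduct; take; drop)
open import Data.List.Properties
  using (map-++; map-∘; map-cong; map-upTo; upTo-∷ʳ; length-map; length-upTo; length-++;
         length-++-≤ˡ; ∷-injective; ≡-dec; take-all; drop-drop)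
open import Data.List.Membership.Propositional using (_∈_)
open import Data.List.Membership.Propositional.Properties
  using (∈-filter⁺; ∈-filter⁻; ∈-allFin; ∈-cartesianProductWith⁺; ∈-cartesianProductWith⁻;
         ∈-cartesianProduct⁺; ∈-concat⁺′; ∈-map⁺; ∈-upTo⁺)
open import Data.List.Membership.Propositional.Properties.WithK using (unique∧set⇒bag)
open import Data.List.Relation.Binary.BagAndSetEquality using (∼bag⇒↭)
open import Data.List.Relation.Binary.Permutation.Propositional.Properties using (↭-length)
open import Data.List.Relation.Unary.Any using (here; there)
import Data.List.Relation.Unary.All as All
import Data.List.Relation.Unary.All.Properties as All
import Data.List.Relation.Unary.AllPairs as AllPairs
import Data.List.Relation.Unary.AllPairs.Properties as AllPairs
open import Data.List.Relation.Unary.Unique.Propositional using (Unique; _∷_)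
open import Data.List.Relation.Unary.Unique.Propositional.Properties
  using (filter⁺; allFin⁺; cartesianProductWith⁺; cartesianProduct⁺; concat⁺; upTo⁺)
open import Data.Nat using (ℕ; zero; suc; _+_; _∸_; _≤_; _<_; z≤n; s≤s)
open import Data.Nat.ListAction using (sum)
open import Data.Nat.ListAction.Properties using (sum-++)
open import Data.Nat.Properties
  using (+-identityʳ; +-suc; +-comm; +-mono-≤; +-monoˡ-≤; +-monoʳ-≤; +-monoʳ-<; +-cancelˡ-≤;
         +-cancelˡ-<; ≤-refl; ≤-trans; ≤-reflexive; ≤-pred; ≤-<-trans; <⇒≤; ≮⇒≥; m≤m+n; m≤n+m;
         m<m+n; n≤1+n; m+[n∸m]≡n; m+n∸m≡n; m<n⇒0<n∸m; ∸-monoˡ-≤; suc-injective; anyUpTo?;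
         +-commutativeSemigroup; module ≤-Reasoning)
open import Data.Product using (_×_; _,_; proj₁; proj₂; ∃; ∃-syntax)
open import Data.Unit using (tt)
open import Function using (_∘_)
open import Function.Bundles using (_⇔_; mk⇔; Equivalence)
open Equivalence using (to; from)
import Function.Properties.Equivalence as ⇔
open import Relation.Binary.PropositionalEquality
open import Relation.Nullary using (¬_; yes; no; contradiction)
open import Relation.Nullary.Decidable using (isYes; toWitness; fromWitness)
open import Relation.Unary using (Decidable)

open CommSemigroupProperties +-commutativeSemigroup
  using (interchange; xy∙z≈x∙zy; xy∙z≈y∙zx; x∙yz≈xz∙y)
module ∧ = CommSemigroupProperties (CommutativeMonoid.commutativeSemigroup ∧-commutativeMonoid)

-- Finite sums

if-split : ∀ b c x → (if b then x else 0) ≡ (if b ∧ c then x else 0) + (if b ∧ not c then x else 0)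
if-split true  true  x = sym (+-identityʳ x)
if-split true  false x = refl
if-split false c     x = refl

if-+ : ∀ b x y → (if b then x else 0) + (if b then y else 0) ≡ (if b then x + y else 0)
if-+ true  x y = refl
if-+ false x y = refl

if-∧ : ∀ b c x → (if b then (if c then x else 0) else 0) ≡ (if b ∧ c then x else 0)
if-∧ true  c x = refl
if-∧ false c x = refl

if-mono : ∀ b {x y} → x ≤ y → (if b then x else 0) ≤ (if b then y else 0)
if-mono true  x≤y = x≤y
if-mono false x≤y = z≤n

if-T : ∀ {b} x → T b → (if b then x else 0) ≡ x
if-T {true} x _ = refl

if-¬T : ∀ {b} x → ¬ T b → (if b then x else 0) ≡ 0
if-¬T {true}  x ¬t = contradiction tt ¬t
if-¬T {false} x _  = refl

if-0 : ∀ b → (if b then 0 else 0) ≡ 0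
if-0 true  = refl
if-0 false = refl

T-not : ∀ {b} → T (not b) ⇔ (¬ T b)
T-not {true}  = mk⇔ (λ ()) (λ ¬t → ¬t tt)
T-not {false} = mk⇔ (λ _ ()) (λ _ → tt)

module _ {A : Set} where

  ∑ : List A → (A → ℕ) → ℕ
  ∑ xs f = sum (map f xs)

  syntax ∑ xs (λ x → e) = ∑[ x ∈ xs ] e

  ∑-cong : ∀ xs {f g : A → ℕ} → (∀ {x} → x ∈ xs → f x ≡ g x) → ∑ xs f ≡ ∑ xs g
  ∑-cong []       f≡g = refl
  ∑-cong (x ∷ xs) f≡g = cong₂ _+_ (f≡g (here refl)) (∑-cong xs (f≡g ∘ there))

  ∑-mono : ∀ xs {f g : A → ℕ} → (∀ {x} → x ∈ xs → f x ≤ g x) → ∑ xs f ≤ ∑ xs g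
  ∑-mono []       f≤g = z≤n
  ∑-mono (x ∷ xs) f≤g = +-mono-≤ (f≤g (here refl)) (∑-mono xs (f≤g ∘ there))

  ∑-zero : ∀ xs {f : A → ℕ} → (∀ {x} → x ∈ xs → f x ≡ 0) → ∑ xs f ≡ 0
  ∑-zero []       f≡0 = refl
  ∑-zero (x ∷ xs) f≡0 = cong₂ _+_ (f≡0 (here refl)) (∑-zero xs (f≡0 ∘ there))

  ∑-≥ : ∀ xs (f : A → ℕ) {x} → x ∈ xs → f x ≤ ∑ xs f
  ∑-≥ (y ∷ xs) f (here refl) = m≤m+n (f y) _
  ∑-≥ (y ∷ xs) f (there x∈)  = ≤-trans (∑-≥ xs f x∈) (m≤n+m _ (f y))

  ∑-+ : ∀ xs (f g : A → ℕ) → ∑[ x ∈ xs ] (f x + g x) ≡ ∑ xs f + ∑ xs g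
  ∑-+ []       f g = refl
  ∑-+ (x ∷ xs) f g = trans (cong ((f x + g x) +_) (∑-+ xs f g)) (interchange (f x) (g x) _ _)

  ∑-++ : ∀ xs ys (f : A → ℕ) → ∑ (xs ++ ys) f ≡ ∑ xs f + ∑ ys f
  ∑-++ xs ys f = trans (cong sum (map-++ f xs ys)) (sum-++ (map f xs) (map f ys))

  ∑-if : ∀ xs b (f : A → ℕ) → ∑[ x ∈ xs ] (if b then f x else 0) ≡ (if b then ∑ xs f else 0)
  ∑-if xs true  f = refl
  ∑-if xs false f = ∑-zero xs (λ _ → refl)

  ∑-single : ∀ {xs x} (f : A → ℕ) → Unique xs → x ∈ xs →
             (∀ {y} → y ∈ xs → y ≢ x → f y ≡ 0) → ∑ xs f ≡ f x
  ∑-single {y ∷ xs} f (y∉xs ∷ _) (here refl) f≡0 =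
    trans (cong (f y +_) (∑-zero xs λ z∈xs → f≡0 (there z∈xs) (All.lookup y∉xs z∈xs ∘ sym)))
          (+-identityʳ (f y))
  ∑-single {y ∷ xs} f (y∉xs ∷ xs!) (there x∈xs) f≡0 =
    cong₂ _+_ (f≡0 (here refl) (λ { refl → All.lookup y∉xs x∈xs refl }))
              (∑-single f xs! x∈xs (f≡0 ∘ there))

  length-filter≡∑ : ∀ xs (test : A → Bool) →
                    length (filter (T? ∘ test) xs) ≡ ∑[ x ∈ xs ] (if test x then 1 else 0)
  length-filter≡∑ []       test = refl
  length-filter≡∑ (x ∷ xs) test with test x
  ... | true  = cong suc (length-filter≡∑ xs test)
  ... | false = length-filter≡∑ xs test

module _ {A B : Set} where

  ∑-map : ∀ (h : A → B) xs (f : B → ℕ) → ∑ (map h xs) f ≡ ∑[ x ∈ xs ] f (h x)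
  ∑-map h xs f = cong sum (sym (map-∘ {g = f} {f = h} xs))

  ∑-comm : ∀ (xs : List A) (ys : List B) (f : A → B → ℕ) →
           ∑[ x ∈ xs ] ∑[ y ∈ ys ] f x y ≡ ∑[ y ∈ ys ] ∑[ x ∈ xs ] f x y
  ∑-comm []       ys f = sym (∑-zero ys (λ _ → refl))
  ∑-comm (x ∷ xs) ys f = trans (cong (∑ ys (f x) +_) (∑-comm xs ys f)) (sym (∑-+ ys (f x) _))

∑-concat : ∀ {A : Set} (xss : List (List A)) (f : A → ℕ) →
           ∑ (concat xss) f ≡ ∑[ xs ∈ xss ] ∑ xs f
∑-concat []         f = refl
∑-concat (xs ∷ xss) f = trans (∑-++ xs (concat xss) f) (cong (∑ xs f +_) (∑-concat xss f))

module _ {A B C : Set} where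

  ∑-cartesianProductWith : ∀ (g : A → B → C) xs ys (f : C → ℕ) →
    ∑ (cartesianProductWith g xs ys) f ≡ ∑[ x ∈ xs ] ∑[ y ∈ ys ] f (g x y)
  ∑-cartesianProductWith g []       ys f = refl
  ∑-cartesianProductWith g (x ∷ xs) ys f =
    trans (∑-++ (map (g x) ys) _ f) (cong₂ _+_ (∑-map (g x) ys f) (∑-cartesianProductWith g xs ys f))

∑-upTo-suc : ∀ T (g : ℕ → ℕ) → ∑ (upTo (suc T)) g ≡ ∑ (upTo T) g + g T
∑-upTo-suc T g = begin
  ∑ (upTo (suc T)) g          ≡⟨ cong (λ ts → ∑ ts g) (upTo-∷ʳ T) ⟨
  ∑ (upTo T ∷ʳ T) g           ≡⟨ ∑-++ (upTo T) (T ∷ []) g ⟩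
  ∑ (upTo T) g + (g T + 0)    ≡⟨ cong (∑ (upTo T) g +_) (+-identityʳ (g T)) ⟩
  ∑ (upTo T) g + g T          ∎
  where open ≡-Reasoning

telescope : ∀ (Φ g : ℕ → ℕ) → (∀ t → Φ t ≤ Φ (suc t) + g t) → ∀ T → Φ 0 ≤ Φ T + ∑[ t ∈ upTo T ] g t
telescope Φ g step zero    = ≤-reflexive (sym (+-identityʳ (Φ 0)))
telescope Φ g step (suc T) = begin
  Φ 0                                ≤⟨ telescope Φ g step T ⟩
  Φ T + ∑ (upTo T) g                 ≤⟨ +-monoˡ-≤ _ (step T) ⟩
  (Φ (suc T) + g T) + ∑ (upTo T) g   ≡⟨ xy∙z≈x∙zy (Φ (suc T)) (g T) _ ⟩
  Φ (suc T) + (∑ (upTo T) g + g T)   ≡⟨ cong (Φ (suc T) +_) (∑-upTo-suc T g) ⟨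
  Φ (suc T) + ∑ (upTo (suc T)) g     ∎
  where open ≤-Reasoning

module _ {A : Set} {P : A → Set} where

  HasCard-unique : ∀ {c d} → HasCard P c → HasCard P d → c ≡ d
  HasCard-unique (xs , refl , xs! , xs⇔P) (ys , refl , ys! , ys⇔P) =
    ↭-length (∼bag⇒↭ (unique∧set⇒bag xs! ys! λ {x} → ⇔.trans (xs⇔P x) (⇔.sym (ys⇔P x))))

  hasCard-∑ : ∀ {us} (test : A → Bool) → Unique us → (∀ {x} → P x → x ∈ us) →
              (∀ {x} → x ∈ us → P x ⇔ T (test x)) →
              HasCard P (∑[ x ∈ us ] (if test x then 1 else 0))
  hasCard-∑ {us} test us! P⊆us P⇔test =
    filter (T? ∘ test) us , length-filter≡∑ us test , filter⁺ (T? ∘ test) us! ,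
    λ x → mk⇔ (λ x∈ → let x∈us , t = ∈-filter⁻ (T? ∘ test) x∈ in from (P⇔test x∈us) t)
              (λ p → ∈-filter⁺ (T? ∘ test) (P⊆us p) (to (P⇔test (P⊆us p)) p))

-- Words

take-++ : ∀ {A : Set} m {xs : List A} ys → m ≤ length xs → take m (xs ++ ys) ≡ take m xs
take-++ zero    ys _ = refl
take-++ (suc m) {x ∷ xs} ys (s≤s m≤) = cong (x ∷_) (take-++ m ys m≤)

drop-++ : ∀ {A : Set} (xs ys : List A) → drop (length xs) (xs ++ ys) ≡ ys
drop-++ []       ys = refl
drop-++ (x ∷ xs) ys = drop-++ xs ys

length≤suc-length-drop1 : ∀ {A : Set} (xs : List A) → length xs ≤ suc (length (drop 1 xs))
length≤suc-length-drop1 []       = z≤n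
length≤suc-length-drop1 (x ∷ xs) = ≤-refl

module _ {k : ℕ} where

  words : ℕ → List (Word k)
  words zero    = [] ∷ []
  words (suc m) = cartesianProductWith _∷_ (allFin k) (words m)

  words-unique : ∀ m → Unique (words m)
  words-unique zero    = All.[] ∷ AllPairs.[]
  words-unique (suc m) = cartesianProductWith⁺ _∷_ ∷-injective (allFin⁺ k) (words-unique m)

  ∈-words : ∀ (v : Word k) → v ∈ words (length v)
  ∈-words []      = here refl
  ∈-words (a ∷ v) = ∈-cartesianProductWith⁺ _∷_ (∈-allFin a) (∈-words v)

  ∈-words⁻ : ∀ m {v : Word k} → v ∈ words m → length v ≡ m
  ∈-words⁻ zero    (here refl) = refl
  ∈-words⁻ (suc m) v∈
    with _ , _ , _ , v′∈ , refl ← ∈-cartesianProductWith⁻ _∷_ (allFin k) (words m) v∈ =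
    cong suc (∈-words⁻ m v′∈)

  ∑-words-suc : ∀ m (f : Word k → ℕ) →
                ∑ (words (suc m)) f ≡ ∑[ a ∈ allFin k ] ∑[ v ∈ words m ] f (a ∷ v)
  ∑-words-suc m = ∑-cartesianProductWith _∷_ (allFin k) (words m)

  ∑-words-++ : ∀ m j (f : Word k → ℕ) →
               ∑ (words (m + j)) f ≡ ∑[ p ∈ words m ] ∑[ s ∈ words j ] f (p ++ s)
  ∑-words-++ zero    j f = sym (+-identityʳ _)
  ∑-words-++ (suc m) j f = begin
    ∑ (words (suc m + j)) f
      ≡⟨ ∑-words-suc (m + j) f ⟩
    ∑[ a ∈ allFin k ] ∑ (words (m + j)) (f ∘ (a ∷_))
      ≡⟨ ∑-cong (allFin k) (λ {a} _ → ∑-words-++ m j (f ∘ (a ∷_))) ⟩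
    ∑[ a ∈ allFin k ] ∑[ p ∈ words m ] ∑[ s ∈ words j ] f (a ∷ p ++ s)
      ≡⟨ ∑-words-suc m _ ⟨
    ∑[ p ∈ words (suc m) ] ∑[ s ∈ words j ] f (p ++ s) ∎
    where open ≡-Reasoning

  ∑-words-∷ʳ : ∀ m (f : Word k → ℕ) →
               ∑ (words (m + 1)) f ≡ ∑[ v ∈ words m ] ∑[ b ∈ allFin k ] f (v ∷ʳ b)
  ∑-words-∷ʳ m f = trans (∑-words-++ m 1 f) (∑-cong (words m) λ {v} _ →
    trans (∑-words-suc 0 (f ∘ (v ++_))) (∑-cong (allFin k) (λ _ → +-identityʳ _)))

  nonemptyWordsUpTo : ℕ → List (Word k)
  nonemptyWordsUpTo T = concatMap (words ∘ suc) (upTo T)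

  nonemptyWordsUpTo-unique : ∀ T → Unique (nonemptyWordsUpTo T)
  nonemptyWordsUpTo-unique T =
    concat⁺ (All.map⁺ (All.universal (words-unique ∘ suc) (upTo T)))
            (AllPairs.map⁺ (AllPairs.map lengths-differ (upTo⁺ T)))
    where
      lengths-differ : ∀ {s t} → s ≢ t → ∀ {v} → ¬ (v ∈ words (suc s) × v ∈ words (suc t))
      lengths-differ s≢t (v∈s , v∈t) =
        s≢t (suc-injective (trans (sym (∈-words⁻ _ v∈s)) (∈-words⁻ _ v∈t)))

  ∈-nonemptyWordsUpTo : ∀ {T} (v : Word k) → 1 ≤ length v → length v ≤ T → v ∈ nonemptyWordsUpTo T
  ∈-nonemptyWordsUpTo (a ∷ v) _ |v|<T =
    ∈-concat⁺′ (∈-words (a ∷ v)) (∈-map⁺ (words ∘ suc) (∈-upTo⁺ |v|<T))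

  ∑-nonemptyWordsUpTo : ∀ T (f : Word k → ℕ) →
                        ∑ (nonemptyWordsUpTo T) f ≡ ∑[ t ∈ upTo T ] ∑ (words (suc t)) f
  ∑-nonemptyWordsUpTo T f =
    trans (∑-concat (map (words ∘ suc) (upTo T)) f) (∑-map (words ∘ suc) (upTo T) (λ ws → ∑ ws f))

-- Occurrences in an infinite word

module _ {k : ℕ} (u : InfWord k) where

  slice-suc : ∀ i m → slice u i (suc m) ≡ u i ∷ slice u (suc i) m
  slice-suc i m = cong₂ _∷_ (cong u (+-identityʳ i)) (begin
    map g (applyUpTo suc m)   ≡⟨ cong (map g) (map-upTo suc m) ⟨
    map g (map suc (upTo m))  ≡⟨ map-∘ (upTo m) ⟨
    map (g ∘ suc) (upTo m)    ≡⟨ map-cong (λ j → cong u (+-suc i j)) (upTo m) ⟩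
    slice u (suc i) m         ∎)
    where
      open ≡-Reasoning
      g : ℕ → Fin k
      g j = u (i + j)

  length-slice : ∀ i m → length (slice u i m) ≡ m
  length-slice i m = trans (length-map _ (upTo m)) (length-upTo m)

  occursAt-slice : ∀ i m → OccursAt u (slice u i m) i
  occursAt-slice i m = cong (slice u i) (length-slice i m)

  occursAt-∷ : ∀ {c x i} → OccursAt u (c ∷ x) i ⇔ (u i ≡ c × OccursAt u x (suc i))
  occursAt-∷ {c} {x} {i} = mk⇔ (∷-injective ∘ trans (sym (slice-suc i (length x))))
                               (λ (ui≡c , occ) → trans (slice-suc i (length x)) (cong₂ _∷_ ui≡c occ))

  occursAt-++ : ∀ x {y i} → OccursAt u (x ++ y) i ⇔ (OccursAt u x i × OccursAt u y (i + length x))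
  occursAt-++ []      {y} {i} = mk⇔ (λ occ → refl , subst (OccursAt u y) (sym (+-identityʳ i)) occ)
                                    (λ (_ , occ) → subst (OccursAt u y) (+-identityʳ i) occ)
  occursAt-++ (c ∷ x) {y} {i} = mk⇔
    (λ occ → let ui≡c , occ′ = to occursAt-∷ occ
                 occx , occy = to (occursAt-++ x) occ′
             in from occursAt-∷ (ui≡c , occx) , subst (OccursAt u y) (sym i+|cx|≡) occy)
    (λ (occcx , occy) → let ui≡c , occx = to occursAt-∷ occcx in
       from occursAt-∷ (ui≡c , from (occursAt-++ x) (occx , subst (OccursAt u y) i+|cx|≡ occy)))
    where
      i+|cx|≡ : i + suc (length x) ≡ suc i + length x
      i+|cx|≡ = +-suc i (length x)

  occursAt-drop1 : ∀ {v i} → OccursAt u v i → OccursAt u (drop 1 v) (suc i)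
  occursAt-drop1 {[]}    _   = refl
  occursAt-drop1 {c ∷ v} occ = proj₂ (to occursAt-∷ occ)

  take-occurs : ∀ {v i m} → OccursAt u v i → m ≤ length v → take m v ≡ slice u i m
  take-occurs {m = zero}          _   _           = refl
  take-occurs {c ∷ v} {i} {suc m} occ (s≤s m≤|v|) =
    let ui≡c , occ′ = to occursAt-∷ occ in
    trans (cong₂ _∷_ (sym ui≡c) (take-occurs occ′ m≤|v|)) (sym (slice-suc i m))

  factor-++⁻ : ∀ x {y} → Factor u (x ++ y) → Factor u x × Factor u y
  factor-++⁻ x (i , occ) = let occx , occy = to (occursAt-++ x) occ in (i , occx) , (_ , occy)

  factor-∷ʳ : ∀ {v} → Factor u v → ∃[ b ] Factor u (v ∷ʳ b)
  factor-∷ʳ {v} (i , occ) = u (i + length v) , i ,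
    from (occursAt-++ v) (occ , cong (_∷ []) (cong u (+-identityʳ _)))

  occursAt-window : ∀ {f i L} → FactorOf f (slice u i L) → ∃[ q ] q ≤ L × OccursAt u f (i + q)
  occursAt-window {f} {i} {L} (pre , suf , pre++f++suf≡) =
    length pre , |pre|≤L , proj₁ (to (occursAt-++ f) (proj₂ (to (occursAt-++ pre) occ)))
    where
      occ : OccursAt u (pre ++ f ++ suf) i
      occ = subst (λ x → OccursAt u x i) (sym pre++f++suf≡) (occursAt-slice i L)
      |pre|≤L : length pre ≤ L
      |pre|≤L = ≤-trans (length-++-≤ˡ pre)
                        (≤-reflexive (trans (cong length pre++f++suf≡) (length-slice i L)))

  BoundedGaps : Word k → ℕ → Set
  BoundedGaps f G = ∀ i → ∃[ q ] q ≤ G × OccursAt u f (i + q)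

  uniformlyRecurrent⇒boundedGaps : UniformlyRecurrent u → ∀ m →
                                   ∃[ N ] ∀ f → Factor u f → length f ≡ m → BoundedGaps f N
  uniformlyRecurrent⇒boundedGaps ur m with N , contains ← ur m =
    N , λ f f-factor |f|≡m i → occursAt-window (contains (slice u i N) (i , occursAt-slice i N)
                                                (≤-reflexive (sym (length-slice i N))) f f-factor |f|≡m)

  factor? : UniformlyRecurrent u → Decidable (Factor u)
  factor? ur f with N , occurs ← uniformlyRecurrent⇒boundedGaps ur (length f)
                  | anyUpTo? (λ i → ≡-dec _≟_ (slice u i (length f)) f) (suc N)
  ... | yes (i , _ , occ) = yes (i , occ)
  ... | no none           =
    no λ f-factor → let q , q≤N , occ = occurs f f-factor refl 0 in none (q , s≤s q≤N , occ)

-- Right extensions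

module RightExtensions {k : ℕ} {u : InfWord k} (factor? : Decidable (Factor u)) where

  isFactor : Word k → Bool
  isFactor v = isYes (factor? v)

  factor⇔isFactor : ∀ {v} → Factor u v ⇔ T (isFactor v)
  factor⇔isFactor = mk⇔ fromWitness toWitness

  χ : Word k → ℕ
  χ v = if isFactor v then 1 else 0

  #rightExt : Word k → ℕ
  #rightExt v = ∑[ b ∈ allFin k ] χ (v ∷ʳ b)

  rightExcess : Word k → ℕ
  rightExcess v = #rightExt v ∸ 1

  complexity : ℕ → ℕ
  complexity m = ∑ (words m) χ

  χ-factor : ∀ {v} → Factor u v → χ v ≡ 1
  χ-factor {v} f with factor? v
  ... | yes _ = refl
  ... | no ¬f = contradiction f ¬f

  χ-nonfactor : ∀ {v} → ¬ Factor u v → χ v ≡ 0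
  χ-nonfactor {v} ¬f with factor? v
  ... | yes f = contradiction f ¬f
  ... | no _  = refl

  #rightExt-nonfactor : ∀ {v} → ¬ Factor u v → #rightExt v ≡ 0
  #rightExt-nonfactor {v} ¬f = ∑-zero (allFin k) λ _ → χ-nonfactor (¬f ∘ proj₁ ∘ factor-++⁻ u v)

  rightExcess-nonfactor : ∀ {v} → ¬ Factor u v → rightExcess v ≡ 0
  rightExcess-nonfactor ¬f = cong (_∸ 1) (#rightExt-nonfactor ¬f)

  #rightExt≡χ+rightExcess : ∀ v → #rightExt v ≡ χ v + rightExcess v
  #rightExt≡χ+rightExcess v with factor? v
  ... | no ¬f = trans (#rightExt-nonfactor ¬f) (sym (rightExcess-nonfactor ¬f))
  ... | yes f = let b , vb-factor = factor-∷ʳ u f in sym (m+[n∸m]≡n (≤-trans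
                  (≤-reflexive (sym (χ-factor vb-factor))) (∑-≥ (allFin k) (χ ∘ (v ∷ʳ_)) (∈-allFin b))))

  hasCard⇒complexity : ∀ {m c} → HasCard (FactorOfLength u m) c → c ≡ complexity m
  hasCard⇒complexity {m} hasCard = HasCard-unique hasCard (hasCard-∑ isFactor (words-unique m)
    (λ {v} (_ , |v|≡m) → subst (λ l → v ∈ words l) |v|≡m (∈-words v))
    (λ v∈ → mk⇔ (to factor⇔isFactor ∘ proj₁) (λ isF → from factor⇔isFactor isF , ∈-words⁻ m v∈)))

  complexity-+1 : ∀ m → complexity (m + 1) ≡ complexity m + ∑ (words m) rightExcess
  complexity-+1 m = trans (∑-words-∷ʳ m χ)
    (trans (∑-cong (words m) (λ {v} _ → #rightExt≡χ+rightExcess v)) (∑-+ (words m) χ rightExcess))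

  -- #BiExt z = Σₐ #rightExt (a z) = #LeftExt z + Σₐ rightExcess (a z), so B(z) ≥ 0 says
  -- exactly that #rightExt z ≤ 1 + Σₐ rightExcess (a z).
  rightExcess≤∑rightExcess∷ : ∀ z → ¬ WeakBispecial u z →
                              rightExcess z ≤ ∑[ a ∈ allFin k ] rightExcess (a ∷ z)
  rightExcess≤∑rightExcess∷ z notWeak with factor? z
  ... | no ¬f = ≤-trans (≤-reflexive (rightExcess-nonfactor ¬f)) z≤n
  ... | yes f = ∸-monoˡ-≤ 1 (+-cancelˡ-≤ l (#rightExt z) (suc D) l+r≤l+1+D)
    where
      l D : ℕ
      l = ∑[ a ∈ allFin k ] χ (a ∷ z)
      D = ∑[ a ∈ allFin k ] rightExcess (a ∷ z)
      letters! = allFin⁺ k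
      hasCard-left : HasCard (LeftExt u z) l
      hasCard-left = hasCard-∑ (isFactor ∘ (_∷ z)) letters! (λ {a} _ → ∈-allFin a) (λ _ → factor⇔isFactor)
      hasCard-right : HasCard (RightExt u z) (#rightExt z)
      hasCard-right =
        hasCard-∑ (isFactor ∘ (z ∷ʳ_)) letters! (λ {b} _ → ∈-allFin b) (λ _ → factor⇔isFactor)
      hasCard-bi : HasCard (BiExt u z) (l + D)
      hasCard-bi = subst (HasCard (BiExt u z)) #bi≡l+D
        (hasCard-∑ (λ (a , b) → isFactor ((a ∷ z) ∷ʳ b)) (cartesianProduct⁺ letters! letters!)
                   (λ {(a , b)} _ → ∈-cartesianProduct⁺ (∈-allFin a) (∈-allFin b)) (λ _ → factor⇔isFactor))
        where
          #bi≡l+D : ∑[ (a , b) ∈ cartesianProduct (allFin k) (allFin k) ] χ ((a ∷ z) ∷ʳ b) ≡ l + D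
          #bi≡l+D = trans (∑-cartesianProductWith _,_ (allFin k) (allFin k) _) (trans
                      (∑-cong (allFin k) (λ {a} _ → #rightExt≡χ+rightExcess (a ∷ z)))
                      (∑-+ (allFin k) (λ a → χ (a ∷ z)) (λ a → rightExcess (a ∷ z))))
      l+r≤l+1+D : l + #rightExt z ≤ l + suc D
      l+r≤l+1+D = subst (l + #rightExt z ≤_) (trans (+-comm (l + D) 1) (sym (+-suc l D)))
        (≮⇒≥ λ lt → notWeak (f , l + D , l , #rightExt z , hasCard-bi , hasCard-left , hasCard-right , lt))

-- Counting return words

module ReturnTree {k : ℕ} {u : InfWord k} (factor? : Decidable (Factor u)) (w : Word k) where

  open RightExtensions {u = u} factor?

  n : ℕ
  n = length w

  startsWith : Word k → Bool
  startsWith v = isYes (≡-dec _≟_ (take n v) w)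

  avoidsBefore : ℕ → Word k → Bool
  avoidsBefore zero    v = true
  avoidsBefore (suc t) v = avoidsBefore t (drop 1 v) ∧ not (startsWith v)

  noReturnWithin : ℕ → Word k → Bool
  noReturnWithin t v = avoidsBefore t (drop 1 v) ∧ startsWith v

  startsWith-self : T (startsWith w)
  startsWith-self = fromWitness (take-all n w ≤-refl)

  startsWith⇒≡ : ∀ {v} → length v ≡ n → T (startsWith v) → v ≡ w
  startsWith⇒≡ {v} |v|≡n sw = trans (sym (take-all n v (≤-reflexive |v|≡n))) (toWitness sw)

  startsWith-++ : ∀ {v} s → n ≤ length v → startsWith (v ++ s) ≡ startsWith v
  startsWith-++ s n≤|v| = cong (λ x → isYes (≡-dec _≟_ x w)) (take-++ n s n≤|v|)

  avoidsBefore-++ : ∀ t {v} s → t + n ≤ suc (length v) → avoidsBefore t (v ++ s) ≡ avoidsBefore t v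
  avoidsBefore-++ zero          s _     = refl
  avoidsBefore-++ (suc zero)    {[]} s bound = cong not (startsWith-++ s (≤-pred bound))
  avoidsBefore-++ (suc (suc t)) {[]} s (s≤s ())
  avoidsBefore-++ (suc t) {c ∷ v} s bound = cong₂ _∧_
    (avoidsBefore-++ t s (≤-pred bound)) (cong not (startsWith-++ s (≤-trans (m≤n+m n t) (≤-pred bound))))

  avoidsBefore-suc : ∀ t v → avoidsBefore (suc t) v ≡ avoidsBefore t v ∧ not (startsWith (drop t v))
  avoidsBefore-suc zero    v = refl
  avoidsBefore-suc (suc t) v = begin
    avoidsBefore (suc t) (drop 1 v) ∧ not (startsWith v)
      ≡⟨ cong (_∧ not (startsWith v)) (avoidsBefore-suc t (drop 1 v)) ⟩
    (avoidsBefore t (drop 1 v) ∧ not (startsWith (drop t (drop 1 v)))) ∧ not (startsWith v)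
      ≡⟨ ∧.xy∙z≈xz∙y (avoidsBefore t (drop 1 v)) _ _ ⟩
    avoidsBefore (suc t) v ∧ not (startsWith (drop t (drop 1 v)))
      ≡⟨ cong (λ x → avoidsBefore (suc t) v ∧ not (startsWith x)) (drop-drop 1 t v) ⟩
    avoidsBefore (suc t) v ∧ not (startsWith (drop (suc t) v)) ∎
    where open ≡-Reasoning

  noReturnWithin-∷ʳ : ∀ t {v} b → length v ≡ t + n → noReturnWithin t (v ∷ʳ b) ≡ noReturnWithin t v
  noReturnWithin-∷ʳ t {v} b |v|≡t+n = cong₂ _∧_ (avoids-tail v |v|≡t+n) (startsWith-++ (b ∷ []) n≤|v|)
    where
      n≤|v| : n ≤ length v
      n≤|v| = ≤-trans (m≤n+m n t) (≤-reflexive (sym |v|≡t+n))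
      avoids-tail : ∀ v → length v ≡ t + n → avoidsBefore t (drop 1 (v ∷ʳ b)) ≡ avoidsBefore t (drop 1 v)
      avoids-tail []      _    = refl
      avoids-tail (c ∷ v) |v|≡ = avoidsBefore-++ t (b ∷ []) (≤-reflexive (sym |v|≡))

  noReturnWithin-suc : ∀ t v →
                       noReturnWithin (suc t) v ≡ noReturnWithin t v ∧ not (startsWith (drop (suc t) v))
  noReturnWithin-suc t v = begin
    avoidsBefore (suc t) (drop 1 v) ∧ startsWith v
      ≡⟨ cong (_∧ startsWith v) (avoidsBefore-suc t (drop 1 v)) ⟩
    (avoidsBefore t (drop 1 v) ∧ not (startsWith (drop t (drop 1 v)))) ∧ startsWith v
      ≡⟨ ∧.xy∙z≈xz∙y (avoidsBefore t (drop 1 v)) _ _ ⟩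
    noReturnWithin t v ∧ not (startsWith (drop t (drop 1 v)))
      ≡⟨ cong (λ x → noReturnWithin t v ∧ not (startsWith x)) (drop-drop 1 t v) ⟩
    noReturnWithin t v ∧ not (startsWith (drop (suc t) v)) ∎
    where open ≡-Reasoning

  startsWith⇔occursAt : ∀ {v i} → OccursAt u v i → n ≤ length v → T (startsWith v) ⇔ OccursAt u w i
  startsWith⇔occursAt occ n≤|v| rewrite take-occurs u occ n≤|v| = mk⇔ toWitness fromWitness

  avoidsBefore⇔ : ∀ t {v i} → OccursAt u v i → t + n ≤ suc (length v) →
                  T (avoidsBefore t v) ⇔ (∀ {q} → q < t → ¬ OccursAt u w (i + q))
  avoidsBefore⇔ zero    _ _ = mk⇔ (λ _ ()) (λ _ → tt)
  avoidsBefore⇔ (suc t) {v} {i} occ bound = mk⇔ avoids⇒none none⇒avoids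
    where
      first⇔ : T (startsWith v) ⇔ OccursAt u w (i + 0)
      first⇔ = subst (λ j → T (startsWith v) ⇔ OccursAt u w j) (sym (+-identityʳ i))
                     (startsWith⇔occursAt occ (≤-trans (m≤n+m n t) (≤-pred bound)))
      rest⇔ : T (avoidsBefore t (drop 1 v)) ⇔ (∀ {q} → q < t → ¬ OccursAt u w (suc i + q))
      rest⇔ = avoidsBefore⇔ t (occursAt-drop1 u occ) (≤-trans (≤-pred bound) (length≤suc-length-drop1 v))
      avoids⇒none : T (avoidsBefore (suc t) v) → ∀ {q} → q < suc t → ¬ OccursAt u w (i + q)
      avoids⇒none av {zero}  _         = to T-not (proj₂ (to T-∧ av)) ∘ from first⇔
      avoids⇒none av {suc q} (s≤s q<t) = to rest⇔ (proj₁ (to T-∧ av)) q<t ∘ subst (OccursAt u w) (+-suc i q)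
      none⇒avoids : (∀ {q} → q < suc t → ¬ OccursAt u w (i + q)) → T (avoidsBefore (suc t) v)
      none⇒avoids none = from T-∧
        ( from rest⇔ (λ {q} q<t → none (s≤s q<t) ∘ subst (OccursAt u w) (sym (+-suc i q)))
        , from T-not (none (s≤s z≤n) ∘ to first⇔))

  avoidsBefore-boundedGaps : ∀ {G t v i} → BoundedGaps u w G → G < t → OccursAt u v i →
                             t + n ≤ suc (length v) → ¬ T (avoidsBefore t v)
  avoidsBefore-boundedGaps {i = i} gaps G<t occ bound av =
    let q , q≤G , occq = gaps i in to (avoidsBefore⇔ _ occ bound) av (≤-<-trans q≤G G<t) occq

  returning : ℕ → Word k → ℕ
  returning t v = if noReturnWithin t v ∧ startsWith (drop (suc t) v) then χ v else 0

  avoidingExcess treeExcess treeNodes returns potential : ℕ → ℕ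
  avoidingExcess t = ∑[ v ∈ words (t + n) ] (if avoidsBefore t (drop 1 v) then rightExcess v else 0)
  treeExcess     t = ∑[ v ∈ words (t + n) ] (if noReturnWithin t v then rightExcess v else 0)
  treeNodes      t = ∑[ v ∈ words (t + n) ] (if noReturnWithin t v then χ v else 0)
  returns        t = ∑ (words (suc t + n)) (returning t)
  potential      t = avoidingExcess t + treeNodes t

  avoidingExcess-step : (∀ z → ¬ WeakBispecial u z) → ∀ t →
                        avoidingExcess t ≤ treeExcess t + avoidingExcess (suc t)
  avoidingExcess-step noWeak t = begin
    avoidingExcess t
      ≡⟨ ∑-cong V (λ {v} _ → if-split (avoidsBefore t (drop 1 v)) (startsWith v) (rightExcess v)) ⟩
    ∑[ v ∈ V ] ((if noReturnWithin t v then rightExcess v else 0) + avoiding v (rightExcess v))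
      ≡⟨ ∑-+ V (λ v → if noReturnWithin t v then rightExcess v else 0) (λ v → avoiding v (rightExcess v)) ⟩
    treeExcess t + ∑[ v ∈ V ] avoiding v (rightExcess v)
      ≤⟨ +-monoʳ-≤ (treeExcess t) (∑-mono V λ {v} _ →
           if-mono (avoidsBefore (suc t) v) (rightExcess≤∑rightExcess∷ v (noWeak v))) ⟩
    treeExcess t + ∑[ v ∈ V ] avoiding v (∑[ a ∈ allFin k ] rightExcess (a ∷ v))
      ≡⟨ cong (treeExcess t +_) (∑-cong V λ {v} _ →
           ∑-if (allFin k) (avoidsBefore (suc t) v) (rightExcess ∘ (_∷ v))) ⟨
    treeExcess t + ∑[ v ∈ V ] ∑[ a ∈ allFin k ] avoiding v (rightExcess (a ∷ v))
      ≡⟨ cong (treeExcess t +_) (∑-comm V (allFin k) (λ v a → avoiding v (rightExcess (a ∷ v)))) ⟩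
    treeExcess t + ∑[ a ∈ allFin k ] ∑[ v ∈ V ] avoiding v (rightExcess (a ∷ v))
      ≡⟨ cong (treeExcess t +_) (∑-words-suc (t + n) (λ v → avoiding (drop 1 v) (rightExcess v))) ⟨
    treeExcess t + avoidingExcess (suc t) ∎
    where
      open ≤-Reasoning
      V : List (Word k)
      V = words (t + n)
      avoiding : Word k → ℕ → ℕ
      avoiding v x = if avoidsBefore (suc t) v then x else 0

  treeNodes-step : ∀ t → treeNodes t + treeExcess t ≡ returns t + treeNodes (suc t)
  treeNodes-step t = begin
    treeNodes t + treeExcess t
      ≡⟨ ∑-+ V node (λ v → if noReturnWithin t v then rightExcess v else 0) ⟨
    ∑[ v ∈ V ] (node v + (if noReturnWithin t v then rightExcess v else 0))
      ≡⟨ ∑-cong V (λ {v} _ → trans (if-+ (noReturnWithin t v) (χ v) (rightExcess v))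
           (cong (λ x → if noReturnWithin t v then x else 0) (sym (#rightExt≡χ+rightExcess v)))) ⟩
    ∑[ v ∈ V ] (if noReturnWithin t v then #rightExt v else 0)
      ≡⟨ ∑-cong V (λ {v} _ → ∑-if (allFin k) (noReturnWithin t v) (χ ∘ (v ∷ʳ_))) ⟨
    ∑[ v ∈ V ] ∑[ b ∈ allFin k ] (if noReturnWithin t v then χ (v ∷ʳ b) else 0)
      ≡⟨ ∑-cong V (λ {v} v∈ → ∑-cong (allFin k) λ {b} _ → cong (λ c → if c then χ (v ∷ʳ b) else 0)
                                                             (sym (noReturnWithin-∷ʳ t b (∈-words⁻ (t + n) v∈)))) ⟩
    ∑[ v ∈ V ] ∑[ b ∈ allFin k ] node (v ∷ʳ b)
      ≡⟨ ∑-words-∷ʳ (t + n) node ⟨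
    ∑ (words (t + n + 1)) node
      ≡⟨ cong (λ m → ∑ (words m) node) (+-comm (t + n) 1) ⟩
    ∑ V′ node
      ≡⟨ ∑-cong V′ (λ {v} _ → if-split (noReturnWithin t v) (startsWith (drop (suc t) v)) (χ v)) ⟩
    ∑[ v ∈ V′ ] (returning t v + continuing v)
      ≡⟨ ∑-+ V′ (returning t) continuing ⟩
    returns t + ∑ V′ continuing
      ≡⟨ cong (returns t +_) (∑-cong V′ λ {v} _ →
           cong (λ c → if c then χ v else 0) (sym (noReturnWithin-suc t v))) ⟩
    returns t + treeNodes (suc t) ∎
    where
      open ≡-Reasoning
      V V′ : List (Word k)
      V  = words (t + n)
      V′ = words (suc t + n)
      node continuing : Word k → ℕ
      node       v = if noReturnWithin t v then χ v else 0
      continuing v = if noReturnWithin t v ∧ not (startsWith (drop (suc t) v)) then χ v else 0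

  potential-step : (∀ z → ¬ WeakBispecial u z) → ∀ t → potential t ≤ potential (suc t) + returns t
  potential-step noWeak t = begin
    avoidingExcess t + treeNodes t                          ≤⟨ +-monoˡ-≤ (treeNodes t) (avoidingExcess-step noWeak t) ⟩
    (treeExcess t + avoidingExcess (suc t)) + treeNodes t   ≡⟨ xy∙z≈y∙zx (treeExcess t) _ _ ⟩
    avoidingExcess (suc t) + (treeNodes t + treeExcess t)   ≡⟨ cong (avoidingExcess (suc t) +_) (treeNodes-step t) ⟩
    avoidingExcess (suc t) + (returns t + treeNodes (suc t)) ≡⟨ x∙yz≈xz∙y (avoidingExcess (suc t)) _ _ ⟩
    potential (suc t) + returns t                           ∎
    where open ≤-Reasoning

  potential-zero : Factor u w → potential 0 ≡ ∑ (words n) rightExcess + 1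
  potential-zero w-factor = cong (∑ (words n) rightExcess +_) (begin
    ∑[ v ∈ words n ] (if startsWith v then χ v else 0)
      ≡⟨ ∑-single (λ v → if startsWith v then χ v else 0) (words-unique n) (∈-words w)
                  (λ v∈ v≢w → if-¬T _ (v≢w ∘ startsWith⇒≡ (∈-words⁻ n v∈))) ⟩
    (if startsWith w then χ w else 0)  ≡⟨ if-T (χ w) startsWith-self ⟩
    χ w                                ≡⟨ χ-factor w-factor ⟩
    1                                  ∎)
    where open ≡-Reasoning

  potential-vanishes : ∀ {G t} → BoundedGaps u w G → G < t → potential t ≡ 0
  potential-vanishes {G} {t} gaps G<t = cong₂ _+_
    (∑-zero (words (t + n)) λ v∈ → vanish _ (∈-words⁻ (t + n) v∈) (λ av → av) rightExcess-nonfactor)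
    (∑-zero (words (t + n)) λ v∈ → vanish _ (∈-words⁻ (t + n) v∈) (proj₁ ∘ to T-∧) χ-nonfactor)
    where
      vanish : ∀ {v} b {x} → length v ≡ t + n → (T b → T (avoidsBefore t (drop 1 v))) →
               (¬ Factor u v → x ≡ 0) → (if b then x else 0) ≡ 0
      vanish {v} b {x} |v|≡ b⇒avoids nonfactor⇒0 with factor? v
      ... | yes (i , occ) = if-¬T x (avoidsBefore-boundedGaps gaps G<t (occursAt-drop1 u occ) bound ∘ b⇒avoids)
        where
          bound : t + n ≤ suc (length (drop 1 v))
          bound = ≤-trans (≤-reflexive (sym |v|≡)) (length≤suc-length-drop1 v)
      ... | no ¬f         = trans (cong (λ y → if b then y else 0) (nonfactor⇒0 ¬f)) (if-0 b)

  ReturnAt : Word k → ℕ → Set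
  ReturnAt p j = 1 ≤ length p × OccursAt u (p ++ w) j × OccursAt u w j ×
                 (∀ {q} → suc q < length p → ¬ OccursAt u w (suc j + q))

  returnWord⇔returnAt : ∀ {p} → ReturnWord u w p ⇔ ∃ (ReturnAt p)
  returnWord⇔returnAt {p} = mk⇔ returnWord⇒returnAt returnAt⇒returnWord
    where
      returnWord⇒returnAt : ReturnWord u w p → ∃ (ReturnAt p)
      returnWord⇒returnAt (j , k′ , j<k′ , occj , occk′ , none , p≡) =
        j , subst (1 ≤_) (sym |p|≡) (m<n⇒0<n∸m j<k′) ,
        from (occursAt-++ u p) (occp , subst (OccursAt u w) (sym k′≡) occk′) , occj ,
        λ {q} sq<|p| → none (suc j + q) (s≤s (m≤m+n j q))
                                        (subst₂ _<_ (+-suc j q) k′≡ (+-monoʳ-< j sq<|p|))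
        where
          |p|≡ : length p ≡ k′ ∸ j
          |p|≡ = trans (cong length p≡) (length-slice u j (k′ ∸ j))
          k′≡ : j + length p ≡ k′
          k′≡ = trans (cong (j +_) |p|≡) (m+[n∸m]≡n (<⇒≤ j<k′))
          occp : OccursAt u p j
          occp = subst (λ x → OccursAt u x j) (sym p≡) (occursAt-slice u j (k′ ∸ j))
      returnAt⇒returnWord : ∃ (ReturnAt p) → ReturnWord u w p
      returnAt⇒returnWord (j , 1≤|p| , occpw , occj , none) =
        j , j + length p , m<m+n j 1≤|p| , occj , proj₂ occp&w , none′ ,
        sym (trans (cong (slice u j) (m+n∸m≡n j (length p))) (proj₁ occp&w))
        where
          occp&w = to (occursAt-++ u p) occpw
          none′ : ∀ m → j < m → m < j + length p → ¬ OccursAt u w m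
          none′ m j<m m<j+|p| =
            none (+-cancelˡ-< j (suc q) (length p) (subst (_< j + length p) (sym m≡) m<j+|p|))
            ∘ subst (OccursAt u w) (sym (m+[n∸m]≡n j<m))
            where
              q = m ∸ suc j
              m≡ : j + suc q ≡ m
              m≡ = trans (+-suc j q) (m+[n∸m]≡n j<m)

  returnWord-length : ∀ {G p} → BoundedGaps u w G → ReturnWord u w p → 1 ≤ length p × length p ≤ suc G
  returnWord-length gaps rw =
    let j , 1≤|p| , _ , _ , none = to returnWord⇔returnAt rw
        q , q≤G , occ = gaps (suc j)
    in 1≤|p| , ≤-trans (≮⇒≥ (λ sq<|p| → none sq<|p| occ)) (s≤s q≤G)

  isReturnWord : Word k → Bool
  isReturnWord []      = false
  isReturnWord (c ∷ p) = noReturnWithin (length p) (c ∷ p ++ w) ∧ isFactor (c ∷ p ++ w)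

  returnWord⇔isReturnWord : ∀ {p} → ReturnWord u w p ⇔ T (isReturnWord p)
  returnWord⇔isReturnWord {[]}    =
    mk⇔ (λ rw → contradiction (proj₁ (proj₂ (to returnWord⇔returnAt rw))) λ ()) λ ()
  returnWord⇔isReturnWord {c ∷ p} = ⇔.trans returnWord⇔returnAt (mk⇔
    (λ (j , _ , occpw , occj , none) → from T-∧
      ( from T-∧ (from (avoids⇔ occpw) (none ∘ s≤s) , from (startsWith⇔occursAt occpw n≤) occj)
      , to factor⇔isFactor (j , occpw)))
    (λ test → let avoids&starts , factor = to T-∧ test
                  avoids , starts = to T-∧ avoids&starts
                  j , occpw = from factor⇔isFactor factor
              in j , s≤s z≤n , occpw , to (startsWith⇔occursAt occpw n≤) starts ,
                 λ {q} sq<|cp| → to (avoids⇔ occpw) avoids (≤-pred sq<|cp|)))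
    where
      |p++w| : length (p ++ w) ≡ length p + n
      |p++w| = length-++ p
      n≤ : n ≤ length (c ∷ p ++ w)
      n≤ = ≤-trans (m≤n+m n (suc (length p))) (≤-reflexive (cong suc (sym |p++w|)))
      avoids⇔ : ∀ {j} → OccursAt u (c ∷ p ++ w) j →
                T (avoidsBefore (length p) (p ++ w)) ⇔ (∀ {q} → q < length p → ¬ OccursAt u w (suc j + q))
      avoids⇔ occpw =
        avoidsBefore⇔ (length p) (occursAt-drop1 u occpw) (≤-trans (≤-reflexive (sym |p++w|)) (n≤1+n _))

  returning≡isReturnWord : ∀ c p →
                           returning (length p) (c ∷ p ++ w) ≡ (if isReturnWord (c ∷ p) then 1 else 0)
  returning≡isReturnWord c p = begin
    (if noReturnWithin t x ∧ startsWith (drop t (p ++ w)) then χ x else 0)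
      ≡⟨ cong (λ b → if noReturnWithin t x ∧ startsWith b then χ x else 0) (drop-++ p w) ⟩
    (if noReturnWithin t x ∧ startsWith w then χ x else 0)
      ≡⟨ cong (λ b → if noReturnWithin t x ∧ b then χ x else 0) (to T-≡ startsWith-self) ⟩
    (if noReturnWithin t x ∧ true then χ x else 0)
      ≡⟨ cong (λ b → if b then χ x else 0) (∧-identityʳ (noReturnWithin t x)) ⟩
    (if noReturnWithin t x then χ x else 0)
      ≡⟨ if-∧ (noReturnWithin t x) (isFactor x) 1 ⟩
    (if isReturnWord (c ∷ p) then 1 else 0) ∎
    where
      open ≡-Reasoning
      t = length p
      x = c ∷ p ++ w

  returns≡∑isReturnWord : ∀ t →
                          returns t ≡ ∑[ p ∈ words (suc t) ] (if isReturnWord p then 1 else 0)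
  returns≡∑isReturnWord t = begin
    ∑ (words (suc t + n)) (returning t)
      ≡⟨ ∑-words-++ (suc t) n (returning t) ⟩
    ∑[ p ∈ words (suc t) ] ∑[ s ∈ words n ] returning t (p ++ s)
      ≡⟨ ∑-cong (words (suc t)) (λ {p} p∈ → ∑-single (returning t ∘ (p ++_)) (words-unique n) (∈-words w)
           λ s∈ s≢w → if-¬T _ (s≢w ∘ endsWith⇒≡ (∈-words⁻ (suc t) p∈) (∈-words⁻ n s∈))) ⟩
    ∑[ p ∈ words (suc t) ] returning t (p ++ w)
      ≡⟨ ∑-cong (words (suc t)) (λ {p} p∈ → returning-w {p} (∈-words⁻ (suc t) p∈)) ⟩
    ∑[ p ∈ words (suc t) ] (if isReturnWord p then 1 else 0) ∎
    where
      open ≡-Reasoning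
      endsWith⇒≡ : ∀ {p s} → length p ≡ suc t → length s ≡ n →
                   T (noReturnWithin t (p ++ s) ∧ startsWith (drop (suc t) (p ++ s))) → s ≡ w
      endsWith⇒≡ {p} {s} |p|≡ |s|≡ test = startsWith⇒≡ |s|≡ (subst (T ∘ startsWith) drop≡s (proj₂ (to T-∧ test)))
        where
          drop≡s : drop (suc t) (p ++ s) ≡ s
          drop≡s = trans (cong (λ m → drop m (p ++ s)) (sym |p|≡)) (drop-++ p s)
      returning-w : ∀ {p} → length p ≡ suc t → returning t (p ++ w) ≡ (if isReturnWord p then 1 else 0)
      returning-w {c ∷ p} |p|≡ = trans (cong (λ t → returning t (c ∷ p ++ w)) (sym (suc-injective |p|≡)))
                                       (returning≡isReturnWord c p)

  #returnWords≡∑returns : ∀ {G r} → BoundedGaps u w G → HasCard (ReturnWord u w) r →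
                          r ≡ ∑[ t ∈ upTo (suc G) ] returns t
  #returnWords≡∑returns {G} {r} gaps hasCard = begin
    r
      ≡⟨ HasCard-unique hasCard hasCard-∑isReturnWord ⟩
    ∑ (nonemptyWordsUpTo (suc G)) indicator
      ≡⟨ ∑-nonemptyWordsUpTo (suc G) indicator ⟩
    ∑[ t ∈ upTo (suc G) ] ∑ (words (suc t)) indicator
      ≡⟨ ∑-cong (upTo (suc G)) (λ {t} _ → returns≡∑isReturnWord t) ⟨
    ∑[ t ∈ upTo (suc G) ] returns t ∎
    where
      open ≡-Reasoning
      indicator : Word k → ℕ
      indicator p = if isReturnWord p then 1 else 0
      hasCard-∑isReturnWord : HasCard (ReturnWord u w) (∑ (nonemptyWordsUpTo (suc G)) indicator)
      hasCard-∑isReturnWord = hasCard-∑ isReturnWord (nonemptyWordsUpTo-unique (suc G))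
        (λ rw → let 1≤|p| , |p|≤ = returnWord-length gaps rw in ∈-nonemptyWordsUpTo _ 1≤|p| |p|≤)
        (λ _ → returnWord⇔isReturnWord)

lemma4p3 : (k : ℕ) (u : InfWord k) → UniformlyRecurrent u →
    (∀ v → ¬ WeakBispecial u v) →
    ∀ w → Factor u w →
    ∀ r c₀ c₁ → HasCard (ReturnWord u w) r →
      HasCard (FactorOfLength u (length w)) c₀ →
      HasCard (FactorOfLength u (length w + 1)) c₁ →
      1 + c₁ ≤ r + c₀
lemma4p3 k u ur noWeak w w-factor r c₀ c₁ hasCard-r hasCard-c₀ hasCard-c₁ = begin
  1 + c₁                                   ≡⟨ cong suc c₁≡ ⟩
  1 + (complexity n + ΔC)                  ≡⟨ +-suc (complexity n) ΔC ⟨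
  complexity n + suc ΔC                    ≡⟨ cong (complexity n +_) (trans (+-comm 1 ΔC) (sym Φ₀≡)) ⟩
  complexity n + potential 0               ≤⟨ +-monoʳ-≤ (complexity n) telescoped ⟩
  complexity n + (potential (suc G) + ∑R)  ≡⟨ cong (λ Φ → complexity n + (Φ + ∑R)) Φ-vanishes ⟩
  complexity n + ∑R                        ≡⟨ cong₂ _+_ c₀≡ r≡ ⟨
  c₀ + r                                   ≡⟨ +-comm c₀ r ⟩
  r + c₀                                   ∎
  where
    open ≤-Reasoning
    open RightExtensions {u = u} (factor? u ur)
    open ReturnTree {u = u} (factor? u ur) w
    G : ℕ
    G = proj₁ (uniformlyRecurrent⇒boundedGaps u ur n)
    gaps : BoundedGaps u w G
    gaps = proj₂ (uniformlyRecurrent⇒boundedGaps u ur n) w w-factor refl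
    ΔC ∑R : ℕ
    ΔC = ∑ (words n) rightExcess
    ∑R = ∑[ t ∈ upTo (suc G) ] returns t
    c₀≡ : c₀ ≡ complexity n
    c₀≡ = hasCard⇒complexity hasCard-c₀
    c₁≡ : c₁ ≡ complexity n + ΔC
    c₁≡ = trans (hasCard⇒complexity hasCard-c₁) (complexity-+1 n)
    r≡ : r ≡ ∑R
    r≡ = #returnWords≡∑returns gaps hasCard-r
    Φ₀≡ : potential 0 ≡ ΔC + 1
    Φ₀≡ = potential-zero w-factor
    telescoped : potential 0 ≤ potential (suc G) + ∑R
    telescoped = telescope potential returns (potential-step noWeak) (suc G)
    Φ-vanishes : potential (suc G) ≡ 0
    Φ-vanishes = potential-vanishes gaps ≤-refl
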